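{- For every integer $n \geq 0$, there is a bijection between the set $L(n)$ of large $(3,2)$-Motzkin paths of length $n$ and the set $NCL(n+1)$ of noncrossing linked partitions of $[n+1]=\{1,2,\ldots,n+1\}$. In particular, $|L(n)| = |NCL(n+1)|$.
   Context: A $(3,2)$-Motzkin path of length $n$ is a lattice path from $(0,0)$ to $(n,0)$ never going below the $x$-axis, consisting of up steps $u=(1,1)$, level steps $(1,0)$ and down steps $(1,-1)$, where each down step receives one of two colors $d_1,d_2$ and each level step receives one of three colors $l_1,l_2,l_3$. A large $(3,2)$-Motzkin path is a $(3,2)$-Motzkin path in which every level step lying on the $x$-axis has color $l_1$ or $l_2$ (i.e. no $l_3$ step on the $x$-axis). A linked partition of $[n]$ is a collection $\pi=\{B_1,\ldots,B_k\}$ of nonempty subsets (blocks) of $[n]$ whose union is $[n]$, such that any two distinct blocks $B_i,B_j$ are nearly disjoint: for every $k\in B_i\cap B_j$, either ($k=\min B_i$, $|B_i|>1$ and $k\neq \min B_j$) or ($k=\min B_j$, $|B_j|>1$ and $k\neq\min B_i$). It is noncrossing if for any two distinct blocks $B_i,B_j$ there do not exist $i_1,j_1\in B_i$ and $i_2,j_2\in B_j$ with $i_1<i_2<j_1<j_2$. $NCL(n)$ denotes the set of noncrossing linked partitions of $[n]$. -}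

module Defs where

open import Data.Nat using (ℕ; zero; suc; _∸_)
import Data.Nat as ℕ
open import Data.Fin using (Fin; zero; suc; _<_; _≤_)
open import Data.Fin.Subset using (Subset; ∣_∣)
import Data.Fin.Subset as S
open import Data.Vec using (Vec; []; _∷_)
open import Data.List using (List)
import Data.List.Membership.Propositional as LM
open import Data.List.Relation.Unary.Unique.Propositional using (Unique)
import Data.List.Relation.Binary.Permutation.Propositional as Perm
open import Data.Product using (Σ; _×_; ∃; proj₁)
open import Data.Sum using (_⊎_)
open import Data.Empty using (⊥)
open import Data.Unit using (⊤)
open import Relation.Nullary using (¬_)
open import Relation.Binary.PropositionalEquality using (_≡_; _≢_)
import Relation.Binary.PropositionalEquality as Eq
open import Relation.Binary.Bundles using (Setoid)
import Relation.Binary.Construct.On as On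

-- Steps: up step u; level step with one of three colours l₁,l₂,l₃
-- (l zero, l (suc zero), l (suc (suc zero))); down step with one of two
-- colours d₁,d₂ (d zero, d (suc zero)).
data Step : Set where
  u : Step
  l : Fin 3 → Step
  d : Fin 2 → Step

l₃ : Fin 3
l₃ = suc (suc zero)

MotzkinFrom : ℕ → {k : ℕ} → Vec Step k → Set
MotzkinFrom h [] = h ≡ 0
MotzkinFrom h (u ∷ s) = MotzkinFrom (suc h) s
MotzkinFrom h (l c ∷ s) = MotzkinFrom h s
MotzkinFrom zero (d c ∷ s) = ⊥
MotzkinFrom (suc h) (d c ∷ s) = MotzkinFrom h s

IsMotzkin : {k : ℕ} → Vec Step k → Set
IsMotzkin s = MotzkinFrom 0 s

NoL₃OnAxisFrom : ℕ → {k : ℕ} → Vec Step k → Set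
NoL₃OnAxisFrom h [] = ⊤
NoL₃OnAxisFrom h (u ∷ s) = NoL₃OnAxisFrom (suc h) s
NoL₃OnAxisFrom h (l c ∷ s) = ¬ (h ≡ 0 × c ≡ l₃) × NoL₃OnAxisFrom h s
NoL₃OnAxisFrom h (d c ∷ s) = NoL₃OnAxisFrom (h ∸ 1) s

IsLargeMotzkin : {k : ℕ} → Vec Step k → Set
IsLargeMotzkin s = IsMotzkin s × NoL₃OnAxisFrom 0 s

L : ℕ → Set
L n = Σ (Vec Step n) IsLargeMotzkin

L-setoid : ℕ → Setoid _ _
L-setoid n = On.setoid {B = L n} (Eq.setoid (Vec Step n)) proj₁

-- Noncrossing linked partitions of [n], with [n] represented by Fin n
-- (element i+1 of [n] is the i : Fin n; the order is preserved).

IsMin : {n : ℕ} → Fin n → Subset n → Set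
IsMin k B = k S.∈ B × (∀ j → j S.∈ B → k ≤ j)

Nonempty : {n : ℕ} → Subset n → Set
Nonempty B = ∃ λ k → k S.∈ B

NearlyDisjoint : {n : ℕ} → Subset n → Subset n → Set
NearlyDisjoint B B' = ∀ k → k S.∈ B → k S.∈ B' →
    (IsMin k B × 1 ℕ.< ∣ B ∣ × ¬ IsMin k B')
  ⊎ (IsMin k B' × 1 ℕ.< ∣ B' ∣ × ¬ IsMin k B)

NoCrossing : {n : ℕ} → Subset n → Subset n → Set
NoCrossing B B' = ∀ i₁ j₁ i₂ j₂ → i₁ S.∈ B → j₁ S.∈ B → i₂ S.∈ B' → j₂ S.∈ B' →
  ¬ (i₁ < i₂ × i₂ < j₁ × j₁ < j₂)

-- A collection of blocks is given by a duplicate-free list of subsets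
-- (the order of the list is irrelevant, see NCL-setoid).
IsNCLinkedPartition : {n : ℕ} → List (Subset n) → Set
IsNCLinkedPartition {n} π =
    Unique π
  × (∀ B → B LM.∈ π → Nonempty B)
  × (∀ (k : Fin n) → ∃ λ B → B LM.∈ π × k S.∈ B)
  × (∀ B B' → B LM.∈ π → B' LM.∈ π → B ≢ B' → NearlyDisjoint B B')
  × (∀ B B' → B LM.∈ π → B' LM.∈ π → B ≢ B' → NoCrossing B B')

NCL : ℕ → Set
NCL n = Σ (List (Subset n)) IsNCLinkedPartition

NCL-setoid : ℕ → Setoid _ _
NCL-setoid n = On.setoid {B = NCL n} (Perm.↭-setoid {A = Subset n}) proj₁

module Submission where

open import Defs
open import Data.Bool using (true; false)
import Data.Bool as Bool
open import Data.Bool.Properties using (T-≡)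
open import Data.Empty using (⊥-elim)
open import Data.Fin using (Fin; zero; suc; toℕ; fromℕ<)
open import Data.Fin.Properties renaming (_≟_ to _≟ᶠ_)
  using (toℕ-injective; toℕ<n; toℕ-fromℕ<; fromℕ<-toℕ; any?)
open import Data.Fin.Subset using (Subset; ∣_∣; ⁅_⁆; _⊆_)
import Data.Fin.Subset as S
open import Data.Fin.Subset.Properties
  using (p⊂q⇒∣p∣<∣q∣; p⊆q⇒∣p∣≤∣q∣; ∣⁅x⁆∣≡1; x∈⁅x⁆; x∈⁅y⁆⇒x≡y; ⊆-antisym; _∈?_)
open import Data.List using (List; []; _∷_; length; map; filter; allFin)
open import Data.List.Properties using (map-cong; filter-≐)
open import Data.List.Membership.Propositional using (_∈_; find; lose)
open import Data.List.Membership.Propositional.Properties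
  using (∈-map⁺; ∈-map⁻; ∈-filter⁺; ∈-filter⁻; ∈-allFin)
open import Data.List.Membership.Propositional.Properties.WithK using (unique∧set⇒bag)
open import Data.List.Relation.Binary.BagAndSetEquality using (∼bag⇒↭)
open import Data.List.Relation.Binary.Permutation.Propositional using (_↭_; ↭-refl; ↭-sym)
open import Data.List.Relation.Binary.Permutation.Propositional.Properties using (∈-resp-↭)
open import Data.List.Relation.Unary.All using (All; []; _∷_)
import Data.List.Relation.Unary.All as All
import Data.List.Relation.Unary.Any as Any
open import Data.List.Relation.Unary.Unique.Propositional using (Unique)
import Data.List.Relation.Unary.Unique.Propositional.Properties as Unique
open import Data.Maybe using (Maybe; just; nothing)
open import Data.Maybe.Properties using (just-injective)
import Data.Maybe.Properties as Maybe
open import Data.Nat using (ℕ; zero; suc; pred; _<_; _≤_; z≤n; s≤s; z<s)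
import Data.Nat as ℕ
open import Data.Nat.Properties
open import Data.Product using (Σ; _×_; _,_; proj₁; proj₂; ∃)
open import Data.Sum using (_⊎_; inj₁; inj₂)
open import Data.Unit using (⊤; tt)
open import Data.Vec using (Vec; []; _∷_; here; there; tabulate)
open import Data.Vec.Properties using (≡-dec; lookup∘tabulate; lookup⇒[]=; []=⇒lookup; tabulate-cong)
open import Function using (_∘_)
open import Function.Bundles using (Bijection; Equivalence; mk⇔)
open import Relation.Binary.Definitions using (DecidableEquality; tri<; tri≈; tri>)
open import Relation.Binary.PropositionalEquality
open import Relation.Nullary using (¬_; ¬?; Dec; yes; no)
open import Relation.Nullary.Decidable using (isYes; toWitness; fromWitness; _⊎-dec_; _×-dec_)

-- A noncrossing linked partition of [N] is determined by its parent function, which sends every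
-- element lying in a block it is not the minimum of to the minimum of that block. These parent
-- functions are exactly those with f j < j whose arcs (f j , j) do not cross, and element 1 never
-- has a parent. On the elements 2, …, n+1 such a function is recorded by a large (3,2)-Motzkin
-- path of length n read from its end: scanning the elements upwards with a stack of elements that
-- still await children, each step says whether the element has no parent, is a further child of
-- the top of the stack (or of 1), or is its last child, which pops the top, and whether the element
-- is pushed. The height of the path is the size of the stack, and an l₃ step on the axis would pop
-- an empty stack. Decoding inverts the encoding step by step on the states that the encoder reaches.

minimum : ∀ {N} → Subset N → ℕ
minimum [] = 0
minimum (true ∷ B) = 0
minimum (false ∷ B) = suc (minimum B)

minimum-≤ : ∀ {N} {B : Subset N} {i} → i S.∈ B → minimum B ≤ toℕ i
minimum-≤ {B = true ∷ B} _ = z≤n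
minimum-≤ {B = false ∷ B} (there i∈B) = s≤s (minimum-≤ i∈B)

minimum-∈ : ∀ {N} {B : Subset N} {i} → i S.∈ B → ∃ λ k → k S.∈ B × toℕ k ≡ minimum B
minimum-∈ {B = true ∷ B} _ = zero , here , refl
minimum-∈ {B = false ∷ B} (there i∈B) with minimum-∈ i∈B
... | k , k∈B , k≡min = suc k , there k∈B , cong suc k≡min

IsMin⇒≡minimum : ∀ {N} {B : Subset N} {k} → IsMin k B → toℕ k ≡ minimum B
IsMin⇒≡minimum (k∈B , k≤) with minimum-∈ k∈B
... | w , w∈B , w≡min = ≤-antisym (subst (_ ≤_) w≡min (k≤ w w∈B)) (minimum-≤ k∈B)

≡minimum⇒IsMin : ∀ {N} {B : Subset N} {k} → k S.∈ B → toℕ k ≡ minimum B → IsMin k B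
≡minimum⇒IsMin k∈B k≡min = k∈B , λ j j∈B → subst (_≤ toℕ j) (sym k≡min) (minimum-≤ j∈B)

x∈p∧y∈p∧x≢y⇒1<∣p∣ : ∀ {N} {B : Subset N} {i j} → i S.∈ B → j S.∈ B → i ≢ j → 1 < ∣ B ∣
x∈p∧y∈p∧x≢y⇒1<∣p∣ {B = B} {i} {j} i∈B j∈B i≢j =
  subst (_< ∣ B ∣) (∣⁅x⁆∣≡1 i) (p⊂q⇒∣p∣<∣q∣ (⁅i⁆⊆B , j , j∈B , j∉⁅i⁆))
  where
  ⁅i⁆⊆B : ⁅ i ⁆ ⊆ B
  ⁅i⁆⊆B k∈⁅i⁆ = subst (S._∈ B) (sym (x∈⁅y⁆⇒x≡y i k∈⁅i⁆)) i∈B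
  j∉⁅i⁆ : ¬ j S.∈ ⁅ i ⁆
  j∉⁅i⁆ j∈⁅i⁆ = i≢j (sym (x∈⁅y⁆⇒x≡y i j∈⁅i⁆))

p⊆⁅x⁆⇒∣p∣≤1 : ∀ {N} {B : Subset N} w → B ⊆ ⁅ w ⁆ → ∣ B ∣ ≤ 1
p⊆⁅x⁆⇒∣p∣≤1 {B = B} w B⊆⁅w⁆ = subst (∣ B ∣ ≤_) (∣⁅x⁆∣≡1 w) (p⊆q⇒∣p∣≤∣q∣ B⊆⁅w⁆)

-- Noncrossing linked partitions from parent functions

ParentFn : Set
ParentFn = ℕ → Maybe ℕ

Decreasing : ParentFn → Set
Decreasing f = ∀ j a → f j ≡ just a → a < j

Noncrossing : ParentFn → Set
Noncrossing f = ∀ a b c d → f b ≡ just a → f d ≡ just c → ¬ (a < c × c < b × b < d)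

AgreeOn : ℕ → ParentFn → ParentFn → Set
AgreeOn N f g = ∀ (i : Fin N) → f (toℕ i) ≡ g (toℕ i)

InBlockOf : ∀ {N} → ParentFn → ℕ → Fin N → Set
InBlockOf f m j = toℕ j ≡ m ⊎ f (toℕ j) ≡ just m

inBlockOf? : ∀ {N} f m (j : Fin N) → Dec (InBlockOf f m j)
inBlockOf? f m j = (toℕ j ℕ.≟ m) ⊎-dec Maybe.≡-dec ℕ._≟_ (f (toℕ j)) (just m)

blockOf : ∀ {N} → ParentFn → ℕ → Subset N
blockOf f m = tabulate (λ j → isYes (inBlockOf? f m j))

∈blockOf⁻ : ∀ {N} {f m} {j : Fin N} → j S.∈ blockOf f m → InBlockOf f m j
∈blockOf⁻ {j = j} j∈ = toWitness (Equivalence.from T-≡ (trans (sym (lookup∘tabulate _ j)) ([]=⇒lookup j∈)))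

∈blockOf⁺ : ∀ {N} {f m} {j : Fin N} → InBlockOf f m j → j S.∈ blockOf f m
∈blockOf⁺ {j = j} j∈ = lookup⇒[]= j _ (trans (lookup∘tabulate _ j) (Equivalence.to T-≡ (fromWitness j∈)))

blockOf-cong : ∀ {N} f g → AgreeOn N f g → ∀ m → blockOf {N} f m ≡ blockOf g m
blockOf-cong f g f≗g m = tabulate-cong same
  where
  same : ∀ j → isYes (inBlockOf? f m j) ≡ isYes (inBlockOf? g m j)
  same j rewrite f≗g j = refl

IsBlockMinimum : ℕ → ParentFn → ℕ → Set
IsBlockMinimum N f m = (∃ λ (j : Fin N) → f (toℕ j) ≡ just m) ⊎ f m ≡ nothing

isBlockMinimum? : ∀ N f m → Dec (IsBlockMinimum N f m)
isBlockMinimum? N f m =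
  any? (λ j → Maybe.≡-dec ℕ._≟_ (f (toℕ j)) (just m)) ⊎-dec Maybe.≡-dec ℕ._≟_ (f m) nothing

isBlockMinimum-cong : ∀ {N} f g → AgreeOn N f g →
                      ∀ (i : Fin N) → IsBlockMinimum N f (toℕ i) → IsBlockMinimum N g (toℕ i)
isBlockMinimum-cong f g f≗g i (inj₁ (j , fj≡i)) = inj₁ (j , trans (sym (f≗g j)) fj≡i)
isBlockMinimum-cong f g f≗g i (inj₂ fi≡nothing) = inj₂ (trans (sym (f≗g i)) fi≡nothing)

blocks : ∀ {N} → ParentFn → List (Subset N)
blocks {N} f = map (λ i → blockOf f (toℕ i)) (filter (λ i → isBlockMinimum? N f (toℕ i)) (allFin N))

∈blocks⁻ : ∀ {N} {f} {B : Subset N} → B ∈ blocks f →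
           ∃ λ i → IsBlockMinimum N f (toℕ i) × B ≡ blockOf f (toℕ i)
∈blocks⁻ {N} {f} B∈ with ∈-map⁻ (λ i → blockOf f (toℕ i)) B∈
... | i , i∈ , B≡ = i , proj₂ (∈-filter⁻ (λ i → isBlockMinimum? N f (toℕ i)) {xs = allFin N} i∈) , B≡

∈blocks⁺ : ∀ {N} {f} (i : Fin N) → IsBlockMinimum N f (toℕ i) → blockOf f (toℕ i) ∈ blocks f
∈blocks⁺ {N} {f} i i-min =
  ∈-map⁺ (λ i → blockOf f (toℕ i)) (∈-filter⁺ (λ i → isBlockMinimum? N f (toℕ i)) (∈-allFin i) i-min)

blocks-cong : ∀ {N} f g → AgreeOn N f g → blocks {N} f ≡ blocks g
blocks-cong {N} f g f≗g = begin
  map (λ i → blockOf f (toℕ i)) (filter (λ i → isBlockMinimum? N f (toℕ i)) (allFin N))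
    ≡⟨ map-cong (λ i → blockOf-cong f g f≗g (toℕ i)) _ ⟩
  map (λ i → blockOf g (toℕ i)) (filter (λ i → isBlockMinimum? N f (toℕ i)) (allFin N))
    ≡⟨ cong (map _) (filter-≐ _ _ (isBlockMinimum-cong f g f≗g _ , isBlockMinimum-cong g f (sym ∘ f≗g) _)
                              (allFin N)) ⟩
  map (λ i → blockOf g (toℕ i)) (filter (λ i → isBlockMinimum? N g (toℕ i)) (allFin N)) ∎
  where open ≡-Reasoning

∈blockOf-self : ∀ {N} f (k : Fin N) → k S.∈ blockOf f (toℕ k)
∈blockOf-self f k = ∈blockOf⁺ {f = f} (inj₁ refl)

∈blockOf⇒parent : ∀ {N} f {m} {x : Fin N} → x S.∈ blockOf f m → m < toℕ x → f (toℕ x) ≡ just m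
∈blockOf⇒parent f x∈ m<x with ∈blockOf⁻ {f = f} x∈
... | inj₁ x≡m = ⊥-elim (<⇒≢ m<x (sym x≡m))
... | inj₂ fx≡m = fx≡m

NonMinimal : ∀ {N} → Fin N → Subset N → Set
NonMinimal i B = i S.∈ B × minimum B ≢ toℕ i

ParentIn : ∀ {N} → List (Subset N) → Fin N → ℕ → Set
ParentIn π i a = ∃ λ B → B ∈ π × NonMinimal i B × minimum B ≡ a

module _ {N : ℕ} {f : ParentFn} (f-dec : Decreasing f) where

  ∈blockOf⇒≤ : ∀ {m} {j : Fin N} → j S.∈ blockOf f m → m ≤ toℕ j
  ∈blockOf⇒≤ j∈ with ∈blockOf⁻ {f = f} j∈
  ... | inj₁ j≡m = ≤-reflexive (sym j≡m)
  ... | inj₂ fj≡m = <⇒≤ (f-dec _ _ fj≡m)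

  parentFin : ∀ (k : Fin N) {a} → f (toℕ k) ≡ just a → ∃ λ (j : Fin N) → toℕ j ≡ a
  parentFin k fk≡a = fromℕ< a<N , toℕ-fromℕ< a<N
    where
    a<N = <-trans (f-dec _ _ fk≡a) (toℕ<n k)

  isMin-blockOf : ∀ (k : Fin N) → IsMin k (blockOf f (toℕ k))
  isMin-blockOf k = ∈blockOf-self f k , λ j j∈ → ∈blockOf⇒≤ j∈

  minimum-blockOf : ∀ (k : Fin N) → minimum (blockOf {N} f (toℕ k)) ≡ toℕ k
  minimum-blockOf k = sym (IsMin⇒≡minimum (isMin-blockOf k))

  blockOf-injective : ∀ {i i' : Fin N} → blockOf {N} f (toℕ i) ≡ blockOf f (toℕ i') → i ≡ i'
  blockOf-injective {i} {i'} B≡B' = toℕ-injective (≤-antisym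
    (∈blockOf⇒≤ (subst (i' S.∈_) (sym B≡B') (∈blockOf-self f i')))
    (∈blockOf⇒≤ (subst (i S.∈_) B≡B' (∈blockOf-self f i))))

  blocks-unique : Unique (blocks {N} f)
  blocks-unique = Unique.map⁺ blockOf-injective (Unique.filter⁺ _ (Unique.allFin⁺ N))

  blocks-nonempty : ∀ B → B ∈ blocks {N} f → Nonempty B
  blocks-nonempty B B∈ with ∈blocks⁻ {f = f} B∈
  ... | i , _ , refl = i , ∈blockOf-self f i

  blocks-parentIn : ∀ (i : Fin N) {a} → f (toℕ i) ≡ just a → ParentIn (blocks f) i a
  blocks-parentIn i fi≡a with parentFin i fi≡a
  ... | j , refl =
    blockOf f (toℕ j) , ∈blocks⁺ {f = f} j (inj₁ (i , fi≡a)) ,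
    (∈blockOf⁺ {f = f} (inj₂ fi≡a) , min≢i) , minimum-blockOf j
    where
    min≢i : minimum (blockOf {N} f (toℕ j)) ≢ toℕ i
    min≢i min≡i = <⇒≢ (f-dec _ _ fi≡a) (trans (sym (minimum-blockOf j)) min≡i)

  blocks-cover : ∀ (k : Fin N) → ∃ λ B → B ∈ blocks f × k S.∈ B
  blocks-cover k with f (toℕ k) in fk≡
  ... | nothing = blockOf f (toℕ k) , ∈blocks⁺ {f = f} k (inj₂ fk≡) , ∈blockOf-self f k
  ... | just a with blocks-parentIn k fk≡
  ... | B , B∈ , (k∈B , _) , _ = B , B∈ , k∈B

  1<∣blockOf∣ : ∀ (i : Fin N) → IsBlockMinimum N f (toℕ i) → ∀ {a} → f (toℕ i) ≡ just a →
                1 < ∣ blockOf {N} f (toℕ i) ∣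
  1<∣blockOf∣ i (inj₁ (j , fj≡i)) _ =
    x∈p∧y∈p∧x≢y⇒1<∣p∣ (∈blockOf-self f i) (∈blockOf⁺ {f = f} (inj₂ fj≡i))
      (λ i≡j → <⇒≢ (f-dec _ _ fj≡i) (cong toℕ i≡j))
  1<∣blockOf∣ i (inj₂ fi≡nothing) fi≡a with () ← trans (sym fi≡nothing) fi≡a

  minimum-and-child : ∀ (i i' k : Fin N) → IsBlockMinimum N f (toℕ i) →
                      toℕ k ≡ toℕ i → f (toℕ k) ≡ just (toℕ i') →
                      IsMin k (blockOf f (toℕ i)) × 1 < ∣ blockOf {N} f (toℕ i) ∣ ×
                      ¬ IsMin k (blockOf f (toℕ i'))
  minimum-and-child i i' k i-min k≡i fk≡i' with toℕ-injective k≡i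
  ... | refl = isMin-blockOf k , 1<∣blockOf∣ k i-min fk≡i' ,
               λ k-min → <⇒≱ (f-dec _ _ fk≡i') (proj₂ k-min i' (∈blockOf-self f i'))

  blocks-nearlyDisjoint : ∀ B B' → B ∈ blocks f → B' ∈ blocks f → B ≢ B' → NearlyDisjoint B B'
  blocks-nearlyDisjoint B B' B∈ B'∈ B≢B' k k∈B k∈B' with ∈blocks⁻ {f = f} B∈ | ∈blocks⁻ {f = f} B'∈
  ... | i , i-min , refl | i' , i'-min , refl with ∈blockOf⁻ {f = f} k∈B | ∈blockOf⁻ {f = f} k∈B'
  ... | inj₁ k≡i | inj₁ k≡i' = ⊥-elim (B≢B' (cong (blockOf f) (trans (sym k≡i) k≡i')))
  ... | inj₁ k≡i | inj₂ fk≡i' = inj₁ (minimum-and-child i i' k i-min k≡i fk≡i')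
  ... | inj₂ fk≡i | inj₁ k≡i' = inj₂ (minimum-and-child i' i k i'-min k≡i' fk≡i)
  ... | inj₂ fk≡i | inj₂ fk≡i' = ⊥-elim (B≢B' (cong (blockOf f) (just-injective (trans (sym fk≡i) fk≡i'))))

  blocks-noCrossing : Noncrossing f → ∀ B B' → B ∈ blocks f → B' ∈ blocks f → B ≢ B' → NoCrossing B B'
  blocks-noCrossing f-nc B B' B∈ B'∈ B≢B' i₁ j₁ i₂ j₂ i₁∈B j₁∈B i₂∈B' j₂∈B' (i₁<i₂ , i₂<j₁ , j₁<j₂)
    with ∈blocks⁻ {f = f} B∈ | ∈blocks⁻ {f = f} B'∈
  ... | i , _ , refl | i' , _ , refl with <-cmp (toℕ i) (toℕ i')
  ... | tri< i<i' _ _ = f-nc _ _ _ _ fj₁≡i fj₂≡i' (i<i' , ≤-<-trans i'≤i₂ i₂<j₁ , j₁<j₂)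
    where
    i≤i₁ = ∈blockOf⇒≤ i₁∈B
    i'≤i₂ = ∈blockOf⇒≤ i₂∈B'
    fj₁≡i = ∈blockOf⇒parent f j₁∈B (≤-<-trans i≤i₁ (<-trans i₁<i₂ i₂<j₁))
    fj₂≡i' = ∈blockOf⇒parent f j₂∈B' (≤-<-trans i'≤i₂ (<-trans i₂<j₁ j₁<j₂))
  ... | tri≈ _ i≡i' _ = B≢B' (cong (blockOf f) i≡i')
  ... | tri> _ _ i'<i = f-nc _ _ _ _ fi₂≡i' fj₁≡i (i'<i , ≤-<-trans i≤i₁ i₁<i₂ , i₂<j₁)
    where
    i≤i₁ = ∈blockOf⇒≤ i₁∈B
    fj₁≡i = ∈blockOf⇒parent f j₁∈B (≤-<-trans i≤i₁ (<-trans i₁<i₂ i₂<j₁))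
    fi₂≡i' = ∈blockOf⇒parent f i₂∈B' (<-≤-trans i'<i (<⇒≤ (≤-<-trans i≤i₁ i₁<i₂)))

  blocks-isNCLinkedPartition : Noncrossing f → IsNCLinkedPartition (blocks {N} f)
  blocks-isNCLinkedPartition f-nc =
    blocks-unique , blocks-nonempty , blocks-cover , blocks-nearlyDisjoint , blocks-noCrossing f-nc

  parentIn-blocks : ∀ (i : Fin N) {a} → ParentIn (blocks f) i a → f (toℕ i) ≡ just a
  parentIn-blocks i (B , B∈ , (i∈B , min≢i) , min≡a) with ∈blocks⁻ {f = f} B∈
  ... | j , _ , refl with ∈blockOf⁻ {f = f} i∈B
  ... | inj₁ i≡j = ⊥-elim (min≢i (trans (minimum-blockOf j) (sym i≡j)))
  ... | inj₂ fi≡j = trans fi≡j (cong just (trans (sym (minimum-blockOf j)) min≡a))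

decreasing-zero : ∀ {f} → Decreasing f → f 0 ≡ nothing
decreasing-zero {f} f-dec with f 0 in f0≡
... | nothing = refl
... | just a with () ← f-dec 0 a f0≡

-- Parent functions from noncrossing linked partitions

nonMinimal? : ∀ {N} (i : Fin N) B → Dec (NonMinimal i B)
nonMinimal? i B = (i ∈? B) ×-dec ¬? (minimum B ℕ.≟ toℕ i)

parentOfFin : ∀ {N} → List (Subset N) → Fin N → Maybe ℕ
parentOfFin π i with Any.any? (nonMinimal? i) π
... | yes i∈π = just (minimum (proj₁ (find i∈π)))
... | no _ = nothing

parentOf : ∀ {N} → List (Subset N) → ParentFn
parentOf {N} π j with j ℕ.<? N
... | yes j<N = parentOfFin π (fromℕ< j<N)
... | no _ = nothing

parentOf-toℕ : ∀ {N} (π : List (Subset N)) i → parentOf π (toℕ i) ≡ parentOfFin π i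
parentOf-toℕ {N} π i with toℕ i ℕ.<? N
... | yes i<N = cong (parentOfFin π) (fromℕ<-toℕ i i<N)
... | no i≮N = ⊥-elim (i≮N (toℕ<n i))

parentOfFin-sound : ∀ {N} (π : List (Subset N)) i {a} → parentOfFin π i ≡ just a → ParentIn π i a
parentOfFin-sound π i pi≡a with Any.any? (nonMinimal? i) π
parentOfFin-sound π i refl | yes i∈π with find i∈π
... | B , B∈ , i-nonmin = B , B∈ , i-nonmin , refl

parentOf-sound : ∀ {N} (π : List (Subset N)) j {a} → parentOf π j ≡ just a →
                 ∃ λ i → toℕ i ≡ j × ParentIn π i a
parentOf-sound {N} π j pj≡a with j ℕ.<? N
... | yes j<N = fromℕ< j<N , toℕ-fromℕ< j<N , parentOfFin-sound π _ pj≡a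

parentIn-< : ∀ {N} {π : List (Subset N)} {i a} → ParentIn π i a → a < toℕ i
parentIn-< (B , _ , (i∈B , min≢i) , refl) = ≤∧≢⇒< (minimum-≤ i∈B) min≢i

parentOf-decreasing : ∀ {N} (π : List (Subset N)) → Decreasing (parentOf π)
parentOf-decreasing π j a pj≡a with parentOf-sound π j pj≡a
... | i , refl , a-parent = parentIn-< a-parent

parentIn-parentOf : ∀ {N} (π : List (Subset N)) i {a} → parentOf π (toℕ i) ≡ just a → ParentIn π i a
parentIn-parentOf π i pi≡a = parentOfFin-sound π i (trans (sym (parentOf-toℕ π i)) pi≡a)

_≟ˢ_ : ∀ {N} → DecidableEquality (Subset N)
_≟ˢ_ = ≡-dec Bool._≟_

module _ {N : ℕ} {π : List (Subset N)} (π-ncl : IsNCLinkedPartition π) where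

  private
    nonempty = proj₁ (proj₂ π-ncl)
    cover = proj₁ (proj₂ (proj₂ π-ncl))
    nearlyDisjoint = proj₁ (proj₂ (proj₂ (proj₂ π-ncl)))
    noCrossing = proj₂ (proj₂ (proj₂ (proj₂ π-ncl)))

  nonMinimal-unique : ∀ {i B B'} → B ∈ π → B' ∈ π → NonMinimal i B → NonMinimal i B' → B ≡ B'
  nonMinimal-unique {i} {B} {B'} B∈ B'∈ (i∈B , min≢i) (i∈B' , min'≢i) with B ≟ˢ B'
  ... | yes B≡B' = B≡B'
  ... | no B≢B' with nearlyDisjoint B B' B∈ B'∈ B≢B' i i∈B i∈B'
  ... | inj₁ (i-min , _) = ⊥-elim (min≢i (sym (IsMin⇒≡minimum i-min)))
  ... | inj₂ (i-min , _) = ⊥-elim (min'≢i (sym (IsMin⇒≡minimum i-min)))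

  minimum-injective : ∀ {B B'} → B ∈ π → B' ∈ π → minimum B ≡ minimum B' → B ≡ B'
  minimum-injective {B} {B'} B∈ B'∈ min≡min' with B ≟ˢ B'
  ... | yes B≡B' = B≡B'
  ... | no B≢B' with minimum-∈ (proj₂ (nonempty B B∈)) | minimum-∈ (proj₂ (nonempty B' B'∈))
  ... | w , w∈B , w≡min | w' , w'∈B' , w'≡min' with toℕ-injective (trans w≡min (trans min≡min' (sym w'≡min')))
  ... | refl with nearlyDisjoint B B' B∈ B'∈ B≢B' w w∈B w'∈B'
  ... | inj₁ (_ , _ , w-not-min') = ⊥-elim (w-not-min' (≡minimum⇒IsMin w'∈B' w'≡min'))
  ... | inj₂ (_ , _ , w-not-min) = ⊥-elim (w-not-min (≡minimum⇒IsMin w∈B w≡min))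

  parentOfFin-complete : ∀ {i B} → B ∈ π → NonMinimal i B → parentOfFin π i ≡ just (minimum B)
  parentOfFin-complete {i} B∈ i-nonmin with Any.any? (nonMinimal? i) π
  ... | yes i∈π = cong (just ∘ minimum)
          (nonMinimal-unique (proj₁ (proj₂ (find i∈π))) B∈ (proj₂ (proj₂ (find i∈π))) i-nonmin)
  ... | no i∉π = ⊥-elim (i∉π (lose B∈ i-nonmin))

  parentOf-complete : ∀ {i B} → B ∈ π → NonMinimal i B → parentOf π (toℕ i) ≡ just (minimum B)
  parentOf-complete {i} B∈ i-nonmin = trans (parentOf-toℕ π i) (parentOfFin-complete B∈ i-nonmin)

  parentOf-noncrossing : Noncrossing (parentOf π)
  parentOf-noncrossing a b c d′ pb≡a pd≡c (a<c , c<b , b<d)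
    with parentOf-sound π b pb≡a | parentOf-sound π d′ pd≡c
  ... | jb , refl , (B , B∈ , (jb∈B , _) , refl) | jd , refl , (B' , B'∈ , (jd∈B' , _) , refl)
    with minimum-∈ jb∈B | minimum-∈ jd∈B'
  ... | ja , ja∈B , ja≡a | jc , jc∈B' , jc≡c =
    noCrossing B B' B∈ B'∈ (λ B≡B' → <⇒≢ a<c (cong minimum B≡B')) ja jb jc jd ja∈B jb∈B jc∈B' jd∈B'
      (subst₂ _<_ (sym ja≡a) (sym jc≡c) a<c , subst (_< toℕ jb) (sym jc≡c) c<b , b<d)

  blockOf-parentOf : ∀ {B} → B ∈ π → B ≡ blockOf (parentOf π) (minimum B)
  blockOf-parentOf {B} B∈ = ⊆-antisym B⊆ ⊆B
    where
    B⊆ : B ⊆ blockOf (parentOf π) (minimum B)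
    B⊆ {j} j∈B with toℕ j ℕ.≟ minimum B
    ... | yes j≡min = ∈blockOf⁺ {f = parentOf π} (inj₁ j≡min)
    ... | no j≢min = ∈blockOf⁺ {f = parentOf π} (inj₂ (parentOf-complete B∈ (j∈B , j≢min ∘ sym)))
    ⊆B : blockOf (parentOf π) (minimum B) ⊆ B
    ⊆B {j} j∈ with ∈blockOf⁻ {f = parentOf π} j∈ | minimum-∈ (proj₂ (nonempty B B∈))
    ... | inj₁ j≡min | w , w∈B , w≡min = subst (S._∈ B) (toℕ-injective (trans w≡min (sym j≡min))) w∈B
    ... | inj₂ pj≡min | _ with parentIn-parentOf π j pj≡min
    ... | B' , B'∈ , (j∈B' , _) , min'≡min = subst (j S.∈_) (minimum-injective B'∈ B∈ min'≡min) j∈B'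

  -- The minimum w of a singleton block {w} has no parent: a second block containing w would
  -- have to contain it as its minimum or share it with a block of size at least two.
  isBlockMinimum-parentOf : ∀ {B w} → B ∈ π → w S.∈ B → toℕ w ≡ minimum B →
                            IsBlockMinimum N (parentOf π) (toℕ w)
  isBlockMinimum-parentOf {B} {w} B∈ w∈B w≡min with any? (λ j → (j ∈? B) ×-dec ¬? (j ≟ᶠ w))
  ... | yes (j , j∈B , j≢w) =
    inj₁ (j , trans (parentOf-complete B∈ (j∈B , min≢j)) (cong just (sym w≡min)))
    where
    min≢j : minimum B ≢ toℕ j
    min≢j min≡j = j≢w (toℕ-injective (trans (sym min≡j) (sym w≡min)))
  ... | no no-other = inj₂ (trans (parentOf-toℕ π w) no-parent)
    where
    B⊆⁅w⁆ : B ⊆ ⁅ w ⁆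
    B⊆⁅w⁆ {j} j∈B with j ≟ᶠ w
    ... | yes refl = x∈⁅x⁆ w
    ... | no j≢w = ⊥-elim (no-other (j , j∈B , j≢w))
    no-parent : parentOfFin π w ≡ nothing
    no-parent with parentOfFin π w in pw≡
    ... | nothing = refl
    ... | just a with parentOfFin-sound π w pw≡
    ... | B' , B'∈ , (w∈B' , min'≢w) , _ with B ≟ˢ B'
    ... | yes refl = ⊥-elim (min'≢w (sym w≡min))
    ... | no B≢B' with nearlyDisjoint B B' B∈ B'∈ B≢B' w w∈B w∈B'
    ... | inj₁ (_ , 1<∣B∣ , _) = ⊥-elim (<⇒≱ 1<∣B∣ (p⊆⁅x⁆⇒∣p∣≤1 w B⊆⁅w⁆))
    ... | inj₂ (w-min' , _) = ⊥-elim (min'≢w (sym (IsMin⇒≡minimum w-min')))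

  block-with-minimum : ∀ i → IsBlockMinimum N (parentOf π) (toℕ i) → ∃ λ B → B ∈ π × minimum B ≡ toℕ i
  block-with-minimum i (inj₁ (j , pj≡i)) with parentIn-parentOf π j pj≡i
  ... | B , B∈ , _ , min≡i = B , B∈ , min≡i
  block-with-minimum i (inj₂ pi≡nothing) with cover i
  ... | B , B∈ , i∈B with minimum B ℕ.≟ toℕ i
  ... | yes min≡i = B , B∈ , min≡i
  ... | no min≢i with () ← trans (sym pi≡nothing) (parentOf-complete B∈ (i∈B , min≢i))

  blocks-parentOf : blocks (parentOf π) ↭ π
  blocks-parentOf =
    ∼bag⇒↭ (unique∧set⇒bag (blocks-unique (parentOf-decreasing π)) (proj₁ π-ncl) (mk⇔ from-blocks to-blocks))
    where
    to-blocks : ∀ {B} → B ∈ π → B ∈ blocks (parentOf π)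
    to-blocks {B} B∈ with minimum-∈ (proj₂ (nonempty B B∈))
    ... | w , w∈B , w≡min = subst (_∈ blocks (parentOf π))
            (sym (trans (blockOf-parentOf B∈) (cong (blockOf (parentOf π)) (sym w≡min))))
            (∈blocks⁺ {f = parentOf π} w (isBlockMinimum-parentOf B∈ w∈B w≡min))
    from-blocks : ∀ {B} → B ∈ blocks (parentOf π) → B ∈ π
    from-blocks B∈ with ∈blocks⁻ {f = parentOf π} B∈
    ... | i , i-min , refl with block-with-minimum i i-min
    ... | B' , B'∈ , min'≡i =
      subst (_∈ π) (trans (blockOf-parentOf B'∈) (cong (blockOf (parentOf π)) min'≡i)) B'∈

≡-via-just : ∀ {A : Set} {x y : Maybe A} →
             (∀ {a} → x ≡ just a → y ≡ just a) → (∀ {a} → y ≡ just a → x ≡ just a) → x ≡ y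
≡-via-just {x = just a} x⇒y _ = sym (x⇒y refl)
≡-via-just {y = just b} _ y⇒x = y⇒x refl
≡-via-just {x = nothing} {nothing} _ _ = refl

parentIn-resp-↭ : ∀ {N} {π π' : List (Subset N)} {i a} → π ↭ π' → ParentIn π i a → ParentIn π' i a
parentIn-resp-↭ π↭π' (B , B∈ , i-nonmin , min≡a) = B , ∈-resp-↭ π↭π' B∈ , i-nonmin , min≡a

blocks-injective : ∀ {N} f g → Decreasing f → Decreasing g → blocks {N} f ↭ blocks g → AgreeOn N f g
blocks-injective f g f-dec g-dec fs↭gs i = ≡-via-just
  (parentIn-blocks g-dec i ∘ parentIn-resp-↭ fs↭gs ∘ blocks-parentIn f-dec i)
  (parentIn-blocks f-dec i ∘ parentIn-resp-↭ (↭-sym fs↭gs) ∘ blocks-parentIn g-dec i)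

_⊑_ : ParentFn → ParentFn → Set
g ⊑ f = ∀ {j a} → g j ≡ just a → f j ≡ just a

Uncovered : ParentFn → ℕ → Set
Uncovered f c = ∀ a b → f b ≡ just a → ¬ (a < c × c < b)

NCForest : ParentFn → Set
NCForest f = Decreasing f × Noncrossing f

ncForest-⊑ : ∀ {f g} → g ⊑ f → NCForest f → NCForest g
ncForest-⊑ g⊑f (f-dec , f-nc) =
  (λ j a gj≡a → f-dec j a (g⊑f gj≡a)) , (λ a b c d′ gb≡a gd≡c → f-nc a b c d′ (g⊑f gb≡a) (g⊑f gd≡c))

uncovered-⊑ : ∀ {f g c} → g ⊑ f → Uncovered f c → Uncovered g c
uncovered-⊑ g⊑f f-unc a b gb≡a = f-unc a b (g⊑f gb≡a)

uncovered-zero : ∀ {f} → Uncovered f 0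
uncovered-zero a b fb≡a (() , _)

-- p : ParentVec m lists the parents of the positions m, m-1, …, 1, head first; position i stands
-- for the element i+1 of [m+1], so position 0 is the root and has no parent.
ParentVec : ℕ → Set
ParentVec m = Vec (Maybe ℕ) m

parent : ∀ {m} → ParentVec m → ParentFn
parent [] j = nothing
parent {suc m} (x ∷ p) j with j ℕ.≟ suc m
... | yes _ = x
... | no _ = parent p j

parent-here : ∀ {m} x (p : ParentVec m) → parent (x ∷ p) (suc m) ≡ x
parent-here {m} x p rewrite ≟-diag (refl {x = suc m}) = refl

parent-there : ∀ {m} x (p : ParentVec m) {j} → j ≢ suc m → parent (x ∷ p) j ≡ parent p j
parent-there x p j≢ rewrite ≢-≟-identity ℕ._≟_ j≢ = refl

parent-≤ : ∀ {m} (p : ParentVec m) {j a} → parent p j ≡ just a → j ≤ m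
parent-≤ {suc m} (x ∷ p) {j} pj≡a with j ℕ.≟ suc m
... | yes refl = ≤-refl
... | no _ = m≤n⇒m≤1+n (parent-≤ p pj≡a)

parent-zero : ∀ {m} (p : ParentVec m) → parent p 0 ≡ nothing
parent-zero [] = refl
parent-zero (x ∷ p) = trans (parent-there x p (λ ())) (parent-zero p)

parent-∷-view : ∀ {m} x (p : ParentVec m) {j a} → parent (x ∷ p) j ≡ just a →
                (j ≡ suc m × x ≡ just a) ⊎ parent p j ≡ just a
parent-∷-view {m} x p {j} pj≡a with j ℕ.≟ suc m
... | yes j≡ = inj₁ (j≡ , pj≡a)
... | no _ = inj₂ pj≡a

parent-⊑-∷ : ∀ {m} x (p : ParentVec m) → parent p ⊑ parent (x ∷ p)
parent-⊑-∷ x p pj≡a = trans (parent-there x p (λ { refl → 1+n≰n (parent-≤ p pj≡a) })) pj≡a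

parent-∷nothing-⊑ : ∀ {m} (p : ParentVec m) → parent (nothing ∷ p) ⊑ parent p
parent-∷nothing-⊑ p {j} pj≡a with parent-∷-view nothing p {j} pj≡a
... | inj₂ pj≡a′ = pj≡a′

parent-injective : ∀ {m} (p q : ParentVec m) → (∀ j → j ≤ m → parent p j ≡ parent q j) → p ≡ q
parent-injective [] [] _ = refl
parent-injective {suc m} (x ∷ p) (y ∷ q) p≗q = cong₂ _∷_ x≡y (parent-injective p q p≗q′)
  where
  x≡y : x ≡ y
  x≡y = trans (sym (parent-here x p)) (trans (p≗q (suc m) ≤-refl) (parent-here y q))
  p≗q′ : ∀ j → j ≤ m → parent p j ≡ parent q j
  p≗q′ j j≤m = trans (sym (parent-there x p j≢)) (trans (p≗q j (m≤n⇒m≤1+n j≤m)) (parent-there y q j≢))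
    where
    j≢ : j ≢ suc m
    j≢ refl = 1+n≰n j≤m

agreeOn-≤ : ∀ {m f g} → AgreeOn (suc m) f g → ∀ j → j ≤ m → f j ≡ g j
agreeOn-≤ {f = f} {g} f≗g j j≤m = subst (λ k → f k ≡ g k) (toℕ-fromℕ< (s≤s j≤m)) (f≗g (fromℕ< (s≤s j≤m)))

restrict : ParentFn → (m : ℕ) → ParentVec m
restrict f zero = []
restrict f (suc m) = f (suc m) ∷ restrict f m

parent-restrict : ∀ f m {j} → 0 < j → j ≤ m → parent (restrict f m) j ≡ f j
parent-restrict f zero {suc j} 0<j ()
parent-restrict f (suc m) {j} 0<j j≤ with j ℕ.≟ suc m
... | yes refl = refl
... | no j≢ = parent-restrict f m 0<j (≤-pred (≤∧≢⇒< j≤ j≢))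

parent-restrict-⊑ : ∀ f m → parent (restrict f m) ⊑ f
parent-restrict-⊑ f m {zero} p0≡a with () ← trans (sym (parent-zero (restrict f m))) p0≡a
parent-restrict-⊑ f m {suc j} pj≡a = trans (sym (parent-restrict f m z<s (parent-≤ (restrict f m) pj≡a))) pj≡a

decreasing-∷ : ∀ {m} {a} (p : ParentVec m) → Decreasing (parent p) → a < suc m →
               Decreasing (parent (just a ∷ p))
decreasing-∷ {a = a} p p-dec a<m j b pj≡b with parent-∷-view (just a) p {j} pj≡b
... | inj₁ (refl , refl) = a<m
... | inj₂ pj≡b′ = p-dec j b pj≡b′

noncrossing-∷ : ∀ {m} {c} (p : ParentVec m) → Noncrossing (parent p) → Uncovered (parent p) c →
                Noncrossing (parent (just c ∷ p))
noncrossing-∷ {m} {c} p p-nc c-unc a b c′ d′ pb≡a pd≡c (a<c , c<b , b<d)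
  with parent-∷-view (just c) p {d′} pd≡c | parent-∷-view (just c) p {b} pb≡a
... | inj₁ (refl , _) | inj₁ (refl , _) = <-irrefl refl b<d
... | inj₂ pd≡c′ | inj₁ (refl , _) = <⇒≱ b<d (m≤n⇒m≤1+n (parent-≤ p pd≡c′))
... | inj₁ (refl , refl) | inj₂ pb≡a′ = c-unc a b pb≡a′ (a<c , c<b)
... | inj₂ pd≡c′ | inj₂ pb≡a′ = p-nc a b c′ d′ pb≡a′ pd≡c′ (a<c , c<b , b<d)

decreasing-head : ∀ {m} {a} (p : ParentVec m) → Decreasing (parent (just a ∷ p)) → a < suc m
decreasing-head {m} p p-dec = p-dec (suc m) _ (parent-here _ p)

noncrossing-head : ∀ {m} {c} (p : ParentVec m) → Noncrossing (parent (just c ∷ p)) → Uncovered (parent p) c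
noncrossing-head {m} p p-nc a b pb≡a (a<c , c<b) =
  p-nc a b _ (suc m) (parent-⊑-∷ _ p pb≡a) (parent-here _ p) (a<c , c<b , s≤s (parent-≤ p pb≡a))

uncovered-new : ∀ {m} x (p : ParentVec m) → Uncovered (parent (x ∷ p)) (suc m)
uncovered-new x p a b pb≡a (_ , m<b) with parent-∷-view x p {b} pb≡a
... | inj₁ (refl , _) = <-irrefl refl m<b
... | inj₂ pb≡a′ = <⇒≱ m<b (m≤n⇒m≤1+n (parent-≤ p pb≡a′))

uncovered-∷ : ∀ {m} {a c} (p : ParentVec m) → c ≤ a → Uncovered (parent p) c →
              Uncovered (parent (just a ∷ p)) c
uncovered-∷ {a = a} p c≤a c-unc a′ b pb≡a′ (a′<c , c<b) with parent-∷-view (just a) p {b} pb≡a′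
... | inj₁ (_ , refl) = <⇒≱ a′<c c≤a
... | inj₂ pb≡a″ = c-unc a′ b pb≡a″ (a′<c , c<b)

ncForest-[] : NCForest (parent [])
ncForest-[] = (λ _ _ ()) , (λ _ _ _ _ ())

ncForest-tail : ∀ {m} x (p : ParentVec m) → NCForest (parent (x ∷ p)) → NCForest (parent p)
ncForest-tail x p = ncForest-⊑ (parent-⊑-∷ x p)

ncForest-∷nothing : ∀ {m} (p : ParentVec m) → NCForest (parent p) → NCForest (parent (nothing ∷ p))
ncForest-∷nothing p = ncForest-⊑ (parent-∷nothing-⊑ p)

ncForest-∷just : ∀ {m} {a} (p : ParentVec m) → NCForest (parent p) → a < suc m → Uncovered (parent p) a →
                 NCForest (parent (just a ∷ p))
ncForest-∷just p (p-dec , p-nc) a<m a-unc = decreasing-∷ p p-dec a<m , noncrossing-∷ p p-nc a-unc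

-- Encoding parent vectors by large Motzkin paths

-- The root 0 lies permanently below the stack.
top : List ℕ → ℕ
top [] = 0
top (c ∷ _) = c

Stack : ℕ → List ℕ → Set
Stack b [] = ⊤
Stack b (c ∷ cs) = 0 < c × c ≤ b × Stack (pred c) cs

stack-top : ∀ {b} cs → Stack b cs → top cs ≤ b
stack-top [] _ = z≤n
stack-top (c ∷ cs) (_ , c≤b , _) = c≤b

stack-retop : ∀ {b} b′ cs → Stack b cs → top cs ≤ b′ → Stack b′ cs
stack-retop b′ [] _ _ = tt
stack-retop b′ (c ∷ cs) (0<c , _ , rest) c≤b′ = 0<c , c≤b′ , rest

stack-weaken : ∀ {b b′} cs → b ≤ b′ → Stack b cs → Stack b′ cs
stack-weaken {b′ = b′} cs b≤b′ stk = stack-retop b′ cs stk (≤-trans (stack-top cs stk) b≤b′)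

stack-tail : ∀ {b} c cs → Stack b (c ∷ cs) → Stack b cs
stack-tail c cs (_ , c≤b , rest) = stack-weaken cs (≤-trans pred[n]≤n c≤b) rest

stack-≤ : ∀ {b} cs → Stack b cs → All (_≤ b) cs
stack-≤ [] _ = []
stack-≤ (c ∷ cs) (_ , c≤b , rest) =
  c≤b ∷ All.map (λ c′≤ → ≤-trans c′≤ (≤-trans pred[n]≤n c≤b)) (stack-≤ cs rest)

stack-≤-top : ∀ {b} cs → Stack b cs → All (_≤ top cs) cs
stack-≤-top [] _ = []
stack-≤-top (c ∷ cs) (_ , _ , rest) = ≤-refl ∷ All.map (λ c′≤ → ≤-trans c′≤ pred[n]≤n) (stack-≤ cs rest)

stack-top-< : ∀ {b} c cs → Stack b (c ∷ cs) → top cs < c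
stack-top-< c [] (0<c , _) = 0<c
stack-top-< (suc c) (c′ ∷ cs) (_ , _ , _ , c′≤c , _) = s≤s c′≤c

stack-push : ∀ {m a} cs → Stack m cs → a < suc m → top cs < a → Stack m (a ∷ cs)
stack-push cs stk a<1+m top<a =
  ≤-trans (s≤s z≤n) top<a , ≤-pred a<1+m , stack-retop _ cs stk (pred-mono-≤ top<a)

stack-zero : ∀ cs → Stack 0 cs → cs ≡ []
stack-zero [] _ = refl
stack-zero (c ∷ cs) (0<c , c≤0 , _) = ⊥-elim (<⇒≱ 0<c c≤0)

uncovered-top : ∀ {f} cs → All (Uncovered f) cs → Uncovered f (top cs)
uncovered-top [] [] = uncovered-zero
uncovered-top (c ∷ cs) (c-unc ∷ _) = c-unc

uncovered-∷nothing : ∀ {m} (p : ParentVec m) {cs} → All (Uncovered (parent p)) cs →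
                     All (Uncovered (parent (nothing ∷ p))) cs
uncovered-∷nothing p = All.map (uncovered-⊑ (parent-∷nothing-⊑ p))

uncovered-∷just : ∀ {m a} (p : ParentVec m) {cs} → All (_≤ a) cs → All (Uncovered (parent p)) cs →
                  All (Uncovered (parent (just a ∷ p))) cs
uncovered-∷just p cs≤a unc = All.zipWith (λ (c≤a , c-unc) → uncovered-∷ p c≤a c-unc) (cs≤a , unc)

uncovered-tail : ∀ {m} x (p : ParentVec m) {cs} → All (Uncovered (parent (x ∷ p))) cs →
                 All (Uncovered (parent p)) cs
uncovered-tail x p = All.map (uncovered-⊑ (parent-⊑-∷ x p))

top-≤-parent : ∀ {m a} (p : ParentVec m) cs → Stack m cs → All (Uncovered (parent (just a ∷ p))) cs →
               top cs ≤ a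
top-≤-parent p [] _ _ = z≤n
top-≤-parent {m} {a} p (c ∷ cs) (_ , c≤m , _) (c-unc ∷ _) =
  ≮⇒≥ (λ a<c → c-unc a (suc m) (parent-here _ p) (a<c , s≤s c≤m))

-- The step i places from the end of a path encodes position i, given the stack of earlier
-- positions still awaiting children. The parent of position m+1 is: none for l₁ and d₁, the top
-- (or the root) for l₂ and d₂, the popped top for u and l₃; and d₁, d₂, l₃ push m+1.
-- u and l₃ on an empty stack, which a Motzkin path never meets, are junk.
encodeStep : ℕ → Step → List ℕ → Maybe ℕ × List ℕ
encodeStep m u [] = nothing , []
encodeStep m u (a ∷ cs) = just a , cs
encodeStep m (l zero) cs = nothing , cs
encodeStep m (l (suc zero)) cs = just (top cs) , cs
encodeStep m (l (suc (suc zero))) [] = nothing , []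
encodeStep m (l (suc (suc zero))) (a ∷ cs) = just a , suc m ∷ cs
encodeStep m (d zero) cs = nothing , suc m ∷ cs
encodeStep m (d (suc zero)) cs = just (top cs) , suc m ∷ cs

encode : ∀ {m} → Vec Step m → ParentVec m × List ℕ
encode [] = [] , []
encode {suc m} (y ∷ s) =
  proj₁ (encodeStep m y (proj₂ (encode s))) ∷ proj₁ (encode s) , proj₂ (encodeStep m y (proj₂ (encode s)))

encode-∷ : ∀ {m} y (s : Vec Step m) {p cs x cs′} → encode s ≡ (p , cs) → encodeStep m y cs ≡ (x , cs′) →
           encode (y ∷ s) ≡ (x ∷ p , cs′)
encode-∷ y s encode≡ step≡ rewrite encode≡ | step≡ = refl

Reachable : (m : ℕ) → ParentVec m → List ℕ → Set
Reachable m p cs = NCForest (parent p) × Stack m cs × All (Uncovered (parent p)) cs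

encodeStep-reachable : ∀ {m} y (p : ParentVec m) cs → Reachable m p cs →
                       Reachable (suc m) (proj₁ (encodeStep m y cs) ∷ p) (proj₂ (encodeStep m y cs))
encodeStep-reachable u p [] (forest , _) = ncForest-∷nothing p forest , tt , []
encodeStep-reachable u p (a ∷ cs) (forest , stk , a-unc ∷ unc) =
  ncForest-∷just p forest (s≤s (stack-top (a ∷ cs) stk)) a-unc ,
  stack-weaken cs (n≤1+n _) (stack-tail a cs stk) ,
  uncovered-∷just p (All.tail (stack-≤-top (a ∷ cs) stk)) unc
encodeStep-reachable (l zero) p cs (forest , stk , unc) =
  ncForest-∷nothing p forest , stack-weaken cs (n≤1+n _) stk , uncovered-∷nothing p unc
encodeStep-reachable (l (suc zero)) p cs (forest , stk , unc) =
  ncForest-∷just p forest (s≤s (stack-top cs stk)) (uncovered-top cs unc) , stack-weaken cs (n≤1+n _) stk ,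
  uncovered-∷just p (stack-≤-top cs stk) unc
encodeStep-reachable (l (suc (suc zero))) p [] (forest , _) = ncForest-∷nothing p forest , tt , []
encodeStep-reachable (l (suc (suc zero))) p (a ∷ cs) (forest , stk , a-unc ∷ unc) =
  ncForest-∷just p forest (s≤s (stack-top (a ∷ cs) stk)) a-unc , (z<s , ≤-refl , stack-tail a cs stk) ,
  uncovered-new _ p ∷ uncovered-∷just p (All.tail (stack-≤-top (a ∷ cs) stk)) unc
encodeStep-reachable (d zero) p cs (forest , stk , unc) =
  ncForest-∷nothing p forest , (z<s , ≤-refl , stk) , uncovered-new _ p ∷ uncovered-∷nothing p unc
encodeStep-reachable (d (suc zero)) p cs (forest , stk , unc) =
  ncForest-∷just p forest (s≤s (stack-top cs stk)) (uncovered-top cs unc) , (z<s , ≤-refl , stk) ,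
  uncovered-new _ p ∷ uncovered-∷just p (stack-≤-top cs stk) unc

encode-reachable : ∀ {m} (s : Vec Step m) → Reachable m (proj₁ (encode s)) (proj₂ (encode s))
encode-reachable [] = ncForest-[] , tt , []
encode-reachable (y ∷ s) = encodeStep-reachable y _ _ (encode-reachable s)

encode-ncForest : ∀ {m} (s : Vec Step m) → NCForest (parent (proj₁ (encode s)))
encode-ncForest s = proj₁ (encode-reachable s)

encode-stack : ∀ {m} (s : Vec Step m) → Stack m (proj₂ (encode s))
encode-stack s = proj₁ (proj₂ (encode-reachable s))

decodeOpening : Maybe ℕ → List ℕ → Step × List ℕ
decodeOpening nothing cs = d zero , cs
decodeOpening (just a) cs with a ℕ.≟ top cs
... | yes _ = d (suc zero) , cs
... | no _ = l l₃ , a ∷ cs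

decodeNonOpening : Maybe ℕ → List ℕ → Step × List ℕ
decodeNonOpening nothing cs = l zero , cs
decodeNonOpening (just a) cs with a ℕ.≟ top cs
... | yes _ = l (suc zero) , cs
... | no _ = u , a ∷ cs

decodeStep : ℕ → Maybe ℕ → List ℕ → Step × List ℕ
decodeStep m x [] = decodeNonOpening x []
decodeStep m x (c ∷ cs) with c ℕ.≟ suc m
... | yes _ = decodeOpening x cs
... | no _ = decodeNonOpening x (c ∷ cs)

decode : ∀ {m} → ParentVec m → List ℕ → Vec Step m
decode [] cs = []
decode {suc m} (x ∷ p) cs = proj₁ (decodeStep m x cs) ∷ decode p (proj₂ (decodeStep m x cs))

decode-∷ : ∀ {m} x (p : ParentVec m) cs {y cs′ s} → decodeStep m x cs ≡ (y , cs′) → decode p cs′ ≡ s →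
           decode (x ∷ p) cs ≡ y ∷ s
decode-∷ x p cs step≡ decode≡ rewrite step≡ | decode≡ = refl

decodeStep-opening : ∀ m x cs → decodeStep m x (suc m ∷ cs) ≡ decodeOpening x cs
decodeStep-opening m x cs rewrite ≟-diag (refl {x = suc m}) = refl

decodeStep-nonOpening : ∀ {m} x cs → Stack m cs → decodeStep m x cs ≡ decodeNonOpening x cs
decodeStep-nonOpening x [] _ = refl
decodeStep-nonOpening {m} x (c ∷ cs) (_ , c≤m , _) with c ℕ.≟ suc m
... | yes refl = ⊥-elim (1+n≰n c≤m)
... | no _ = refl

decodeOpening-top : ∀ cs → decodeOpening (just (top cs)) cs ≡ (d (suc zero) , cs)
decodeOpening-top cs rewrite ≟-diag (refl {x = top cs}) = refl

decodeOpening-new : ∀ {a} cs → a ≢ top cs → decodeOpening (just a) cs ≡ (l l₃ , a ∷ cs)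
decodeOpening-new cs a≢ rewrite ≢-≟-identity ℕ._≟_ a≢ = refl

decodeNonOpening-top : ∀ cs → decodeNonOpening (just (top cs)) cs ≡ (l (suc zero) , cs)
decodeNonOpening-top cs rewrite ≟-diag (refl {x = top cs}) = refl

decodeNonOpening-new : ∀ {a} cs → a ≢ top cs → decodeNonOpening (just a) cs ≡ (u , a ∷ cs)
decodeNonOpening-new cs a≢ rewrite ≢-≟-identity ℕ._≟_ a≢ = refl

stack-head-≢ : ∀ {b} a cs → Stack b (a ∷ cs) → a ≢ top cs
stack-head-≢ a cs stk a≡top = <⇒≢ (stack-top-< a cs stk) (sym a≡top)

LargeFrom : ℕ → ∀ {k} → Vec Step k → Set
LargeFrom h s = MotzkinFrom h s × NoL₃OnAxisFrom h s

decode-encode : ∀ {m} h (s : Vec Step m) → LargeFrom h s →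
                length (proj₂ (encode s)) ≡ h × decode (proj₁ (encode s)) (proj₂ (encode s)) ≡ s
decode-encode h [] (h≡0 , _) = sym h≡0 , refl
decode-encode {suc m} h (u ∷ s) large
  with encode s | encode-stack s | decode-encode (suc h) s large
... | p , [] | _ | () , _
... | p , a ∷ cs | stk | len , decoded =
  suc-injective len ,
  decode-∷ (just a) p cs
    (trans (decodeStep-nonOpening (just a) cs (stack-tail a cs stk))
           (decodeNonOpening-new cs (stack-head-≢ a cs stk)))
    decoded
decode-encode {suc m} h (l zero ∷ s) (M , _ , N)
  with encode s | encode-stack s | decode-encode h s (M , N)
... | p , cs | stk | len , decoded =
  len , decode-∷ nothing p cs (decodeStep-nonOpening nothing cs stk) decoded
decode-encode {suc m} h (l (suc zero) ∷ s) (M , _ , N)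
  with encode s | encode-stack s | decode-encode h s (M , N)
... | p , cs | stk | len , decoded =
  len , decode-∷ (just (top cs)) p cs (trans (decodeStep-nonOpening _ cs stk) (decodeNonOpening-top cs)) decoded
decode-encode {suc m} zero (l (suc (suc zero)) ∷ s) (_ , no-l₃ , _) = ⊥-elim (no-l₃ (refl , refl))
decode-encode {suc m} (suc h) (l (suc (suc zero)) ∷ s) (M , _ , N)
  with encode s | encode-stack s | decode-encode (suc h) s (M , N)
... | p , [] | _ | () , _
... | p , a ∷ cs | stk | len , decoded =
  len ,
  decode-∷ (just a) p (suc m ∷ cs)
    (trans (decodeStep-opening m (just a) cs) (decodeOpening-new cs (stack-head-≢ a cs stk)))
    decoded
decode-encode {suc m} zero (d c ∷ s) (() , _)
decode-encode {suc m} (suc h) (d zero ∷ s) large with encode s | decode-encode h s large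
... | p , cs | len , decoded =
  cong suc len , decode-∷ nothing p (suc m ∷ cs) (decodeStep-opening m nothing cs) decoded
decode-encode {suc m} (suc h) (d (suc zero) ∷ s) large with encode s | decode-encode h s large
... | p , cs | len , decoded =
  cong suc len ,
  decode-∷ (just (top cs)) p (suc m ∷ cs) (trans (decodeStep-opening m _ cs) (decodeOpening-top cs)) decoded

data StackTop (m : ℕ) : List ℕ → Set where
  opened : ∀ {cs} → Stack m cs → StackTop m (suc m ∷ cs)
  notOpened : ∀ {cs} → Stack m cs → StackTop m cs

stackTop : ∀ m cs → Stack (suc m) cs → StackTop m cs
stackTop m [] _ = notOpened tt
stackTop m (c ∷ cs) (0<c , c≤ , rest) with c ℕ.≟ suc m
... | yes refl = opened rest
... | no c≢ = notOpened (0<c , ≤-pred (≤∧≢⇒< c≤ c≢) , rest)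

InvertsStep : (m : ℕ) → Maybe ℕ → ParentVec m → List ℕ → Step × List ℕ → Set
InvertsStep m x p cs (y , cs₀) =
  Reachable m p cs₀ × encodeStep m y cs₀ ≡ (x , cs) ×
  (∀ {k} (r : Vec Step k) → LargeFrom (length cs₀) r → LargeFrom (length cs) (y ∷ r))

reachable-tail : ∀ {m} x (p : ParentVec m) cs → NCForest (parent (x ∷ p)) → Stack m cs →
                 All (Uncovered (parent (x ∷ p))) cs → Reachable m p cs
reachable-tail x p cs forest stk unc = ncForest-tail x p forest , stk , uncovered-tail x p unc

reachable-push : ∀ {m a} (p : ParentVec m) cs → NCForest (parent (just a ∷ p)) → Stack m cs →
                 All (Uncovered (parent (just a ∷ p))) cs → a ≢ top cs → Reachable m p (a ∷ cs)
reachable-push p cs forest@(p-dec , p-nc) stk unc a≢top =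
  ncForest-tail _ p forest , stack-push cs stk (decreasing-head p p-dec) top<a ,
  noncrossing-head p p-nc ∷ uncovered-tail _ p unc
  where
  top<a = ≤∧≢⇒< (top-≤-parent p cs stk unc) (a≢top ∘ sym)

large-level : ∀ {h k c} (r : Vec Step k) → ¬ (h ≡ 0 × c ≡ l₃) → LargeFrom h r → LargeFrom h (l c ∷ r)
large-level _ no-l₃ (M , N) = M , no-l₃ , N

decodeStep-inverts : ∀ {m} x (p : ParentVec m) cs → Reachable (suc m) (x ∷ p) cs →
                     InvertsStep m x p cs (decodeStep m x cs)
decodeStep-inverts {m} nothing p cs (forest , stk , unc) with stackTop m cs stk
... | opened {cs₀} stk₀ rewrite decodeStep-opening m nothing cs₀ =
  reachable-tail nothing p cs₀ forest stk₀ (All.tail unc) , refl , λ _ large → large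
... | notOpened stk′ rewrite decodeStep-nonOpening nothing cs stk′ =
  reachable-tail nothing p cs forest stk′ unc , refl , λ r → large-level r λ { (_ , ()) }
decodeStep-inverts {m} (just a) p cs (forest , stk , unc) with stackTop m cs stk
... | opened {cs₀} stk₀ rewrite decodeStep-opening m (just a) cs₀ with a ℕ.≟ top cs₀
...   | yes refl = reachable-tail _ p cs₀ forest stk₀ (All.tail unc) , refl , λ _ large → large
...   | no a≢top =
  reachable-push p cs₀ forest stk₀ (All.tail unc) a≢top , refl , λ r → large-level r λ { (() , _) }
decodeStep-inverts {m} (just a) p cs (forest , stk , unc) | notOpened stk′
  rewrite decodeStep-nonOpening (just a) cs stk′ with a ℕ.≟ top cs
... | yes refl = reachable-tail _ p cs forest stk′ unc , refl , λ r → large-level r λ { (_ , ()) }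
... | no a≢top = reachable-push p cs forest stk′ unc a≢top , refl , λ _ large → large

encode-decode : ∀ {m} (p : ParentVec m) cs → Reachable m p cs →
                LargeFrom (length cs) (decode p cs) × encode (decode p cs) ≡ (p , cs)
encode-decode [] cs (_ , stk , _) rewrite stack-zero cs stk = (refl , tt) , refl
encode-decode {suc m} (x ∷ p) cs r with decodeStep-inverts x p cs r
... | r₀ , step≡ , large-∷ with encode-decode p _ r₀
... | large , encode≡ = large-∷ _ large , encode-∷ _ (decode p _) encode≡ step≡

restrict-reachable : ∀ {f} → NCForest f → ∀ m → Reachable m (restrict f m) []
restrict-reachable {f} forest m = ncForest-⊑ (parent-restrict-⊑ f m) forest , tt , []

parent-restrict-agrees : ∀ {f} → Decreasing f → ∀ n → AgreeOn (suc n) (parent (restrict f n)) f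
parent-restrict-agrees {f} f-dec n zero = trans (parent-zero (restrict f n)) (sym (decreasing-zero f-dec))
parent-restrict-agrees {f} f-dec n (suc i) = parent-restrict f n z<s (toℕ<n i)

decode-encode-large : ∀ {m} (s : Vec Step m) → IsLargeMotzkin s → decode (proj₁ (encode s)) [] ≡ s
decode-encode-large s large with proj₂ (encode s) | decode-encode 0 s large
... | [] | _ , decoded = decoded

module _ (n : ℕ) where

  toNCL : L n → NCL (suc n)
  toNCL (s , _) =
    blocks (parent (proj₁ (encode s))) , blocks-isNCLinkedPartition (proj₁ forest) (proj₂ forest)
    where
    forest = encode-ncForest s

  toNCL-injective : ∀ {s t : L n} → proj₁ (toNCL s) ↭ proj₁ (toNCL t) → proj₁ s ≡ proj₁ t
  toNCL-injective {s , s-large} {t , t-large} blocks↭ = begin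
    s                       ≡⟨ sym (decode-encode-large s s-large) ⟩
    decode (parents s) []   ≡⟨ cong (λ p → decode p []) parents≡ ⟩
    decode (parents t) []   ≡⟨ decode-encode-large t t-large ⟩
    t                       ∎
    where
    open ≡-Reasoning
    parents : Vec Step n → ParentVec n
    parents s = proj₁ (encode s)
    agree = blocks-injective (parent (parents s)) (parent (parents t))
              (proj₁ (encode-ncForest s)) (proj₁ (encode-ncForest t)) blocks↭
    parents≡ : parents s ≡ parents t
    parents≡ = parent-injective (parents s) (parents t) (agreeOn-≤ agree)

  toNCL-surjective : ∀ (π : NCL (suc n)) →
                     Σ (L n) λ s → ∀ {t : L n} → proj₁ t ≡ proj₁ s → proj₁ (toNCL t) ↭ proj₁ π
  toNCL-surjective (π , π-ncl) = (decode p [] , large) , λ { {t , _} refl → blocks↭π }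
    where
    f-dec = parentOf-decreasing π
    p = restrict (parentOf π) n
    decoded = encode-decode p [] (restrict-reachable (f-dec , parentOf-noncrossing π-ncl) n)
    large = proj₁ decoded
    blocks↭π : blocks (parent (proj₁ (encode (decode p [])))) ↭ π
    blocks↭π rewrite proj₂ decoded | blocks-cong (parent p) (parentOf π) (parent-restrict-agrees f-dec n) =
      blocks-parentOf π-ncl

mainTheorem1 : (n : ℕ) → Bijection (L-setoid n) (NCL-setoid (suc n))
mainTheorem1 n = record
  { to = toNCL n
  ; cong = λ { refl → ↭-refl }
  ; bijective = (λ {s} {t} → toNCL-injective n {s} {t}) , toNCL-surjective n
  }
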